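{- Let $n$, $2s$, $r_1$, $r_2$ be positive integers with $n\ge 2s+1\ge 5$, and let $r=r_1+r_2$. For positive integers $t\le s$ define $$h(t)=\binom{2s-t}{r}\binom{r}{r_{1}} +\sum_{j=1}^{2}\binom{t}{r_{j}}\left[\binom{n-r_{j}-1}{r-r_{j}}-\binom{2s-t-r_{j}}{r-r_{j}}\right].$$ Then $h$ is a convex function of $t$, i.e. $h(t+1)+h(t-1)\ge 2h(t)$ for every integer $t$ with $t-1\ge 1$ and $t+1\le s$.
   Context: Binomial coefficients follow the combinatorial convention: for integers $a$ and $b$, $\binom{a}{b}$ is the number of $b$-element subsets of an $a$-element set when $0\le b\le a$, and $\binom{a}{b}=0$ otherwise. -}

module Defs where

open import Data.Nat using (ℕ) renaming (_+_ to _+ℕ_; _*_ to _*ℕ_)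
open import Data.Nat.Combinatorics using (_C_)
open import Data.Integer using (ℤ; +_; -[1+_]; _+_; _-_; _*_)

-- Combinatorial binomial coefficient on integers:
-- binom a b = number of b-subsets of an a-set if 0 ≤ b ≤ a, and 0 otherwise.
-- (For naturals, stdlib's  a C b  is already 0 when b > a.)
binom : ℤ → ℤ → ℤ
binom (+ a) (+ b) = + (a C b)
binom (+ a) -[1+ b ] = + 0
binom -[1+ a ] b = + 0

-- h(t) with parameters n, m = 2s, r₁, r₂ (r = r₁ + r₂), everything in ℤ.
h : (n m r₁ r₂ t : ℕ) → ℤ
h n m r₁ r₂ t =
  binom (+ m - + t) (+ r) * binom (+ r) (+ r₁)
  + binom (+ t) (+ r₁) * (binom (+ n - + r₁ - + 1) (+ r - + r₁) - binom (+ m - + t - + r₁) (+ r - + r₁))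
  + binom (+ t) (+ r₂) * (binom (+ n - + r₂ - + 1) (+ r - + r₂) - binom (+ m - + t - + r₂) (+ r - + r₂))
  where
  r : ℕ
  r = r₁ +ℕ r₂

{-# OPTIONS --safe #-}
module Submission where

-- Put r = r₁ + r₂ and, for a middle point t, X = m − t − 1. Then h(t) = K·C(m−t, r) + Σⱼ uⱼ vⱼ with
-- K = C(r, r₁), uⱼ = C(t, rⱼ), vⱼ = Nⱼ − wⱼ and wⱼ = C(m−t−rⱼ, r−rⱼ), Nⱼ constant in t.
-- The first term has second difference K·C(X, r−2). By the discrete Leibniz rule
--   Δ²(uv) = u(t)Δ²v + v(t)Δ²u + Δ₊u Δ₊v + Δ₋u Δ₋v,
-- and as u is nondecreasing and convex while v is nondecreasing and, since m ≤ n, nonnegative,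
--   Δ²(uⱼvⱼ) ≥ −C(t, rⱼ)·Δ²wⱼ = −C(t, rⱼ)·C(X−rⱼ, r−rⱼ−2) ≥ −C(X, rⱼ)·C(X−rⱼ, r−rⱼ−2) = −C(X, r−2)·C(r−2, rⱼ).
-- Finally C(r−2, r₁) + C(r−2, r₂) ≤ C(r, r₁), so the first term absorbs both losses.

open import Defs
open import Data.Nat.Base using (ℕ)

module BinomialCoefficients where
  open import Data.Nat
  open import Data.Nat.Properties
  open import Data.Nat.Combinatorics
  open import Data.Nat.DivMod using (_/_; m/n*n≡m)
  open import Data.Nat.Tactic.RingSolver using (solve-∀)
  open import Relation.Binary.PropositionalEquality
  open import Relation.Nullary using (yes; no)
  open ≤-Reasoning

  nCk≤[1+n]Ck : ∀ n k → n C k ≤ suc n C k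
  nCk≤[1+n]Ck n zero    = ≤-refl
  nCk≤[1+n]Ck n (suc k) = begin
    n C suc k             ≤⟨ m≤n+m (n C suc k) (n C k) ⟩
    n C k + n C suc k     ≡⟨ nCk+nC[k+1]≡[n+1]C[k+1] n k ⟩
    suc n C suc k         ∎

  C-monoˡ-≤ : ∀ k {m n} → m ≤ n → m C k ≤ n C k
  C-monoˡ-≤ k {m} m≤n = go (≤⇒≤′ m≤n)
    where
    go : ∀ {n} → m ≤′ n → m C k ≤ n C k
    go ≤′-refl            = ≤-refl
    go (≤′-step {n} m≤′n) = ≤-trans (go m≤′n) (nCk≤[1+n]Ck n k)

  nCk*k!*[n∸k]!≡n! : ∀ {n k} → k ≤ n → (n C k) * (k ! * (n ∸ k) !) ≡ n !
  nCk*k!*[n∸k]!≡n! {n} {k} k≤n = begin-equality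
    (n C k) * (k ! * (n ∸ k) !)                ≡⟨ cong (_* (k ! * (n ∸ k) !)) (nCk≡n!/k![n-k]! k≤n) ⟩
    (n ! / (k ! * (n ∸ k) !)) * (k ! * (n ∸ k) !) ≡⟨ m/n*n≡m (k![n∸k]!∣n! k≤n) ⟩
    n !                                        ∎
    where instance _ = k !* (n ∸ k) !≢0

  nCa*[n∸a]Cc≡nC[a+c]*[a+c]Ca : ∀ n a c →
    (n C a) * ((n ∸ a) C c) ≡ (n C (a + c)) * ((a + c) C a)
  nCa*[n∸a]Cc≡nC[a+c]*[a+c]Ca n a c with a + c ≤? n | a ≤? n
  ... | yes a+c≤n | _ = *-cancelʳ-≡ _ _ (a ! * (c ! * (n ∸ (a + c)) !)) (begin-equality
    (n C a) * ((n ∸ a) C c) * (a ! * (c ! * (n ∸ (a + c)) !))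
      ≡⟨ regroup (n C a) ((n ∸ a) C c) (a !) (c !) ((n ∸ (a + c)) !) ⟩
    (n C a) * (a ! * (((n ∸ a) C c) * (c ! * (n ∸ (a + c)) !)))
      ≡⟨ cong (λ x → (n C a) * (a ! * (((n ∸ a) C c) * (c ! * x !)))) (∸-+-assoc n a c) ⟨
    (n C a) * (a ! * (((n ∸ a) C c) * (c ! * ((n ∸ a) ∸ c) !)))
      ≡⟨ cong (λ x → (n C a) * (a ! * x)) (nCk*k!*[n∸k]!≡n! c≤n∸a) ⟩
    (n C a) * (a ! * (n ∸ a) !)
      ≡⟨ nCk*k!*[n∸k]!≡n! a≤n ⟩
    n !
      ≡⟨ nCk*k!*[n∸k]!≡n! a+c≤n ⟨
    (n C (a + c)) * ((a + c) ! * (n ∸ (a + c)) !)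
      ≡⟨ cong (λ x → (n C (a + c)) * (x * (n ∸ (a + c)) !)) (nCk*k!*[n∸k]!≡n! (m≤m+n a c)) ⟨
    (n C (a + c)) * (((a + c) C a) * (a ! * ((a + c) ∸ a) !) * (n ∸ (a + c)) !)
      ≡⟨ cong (λ x → (n C (a + c)) * (((a + c) C a) * (a ! * x !) * (n ∸ (a + c)) !)) (m+n∸m≡n a c) ⟩
    (n C (a + c)) * (((a + c) C a) * (a ! * c !) * (n ∸ (a + c)) !)
      ≡⟨ regroup′ (n C (a + c)) ((a + c) C a) (a !) (c !) ((n ∸ (a + c)) !) ⟩
    (n C (a + c)) * ((a + c) C a) * (a ! * (c ! * (n ∸ (a + c)) !)) ∎)
    where
    instance
      _ = m*n≢0 (a !) (c ! * (n ∸ (a + c)) !) {{a !≢0}} {{m*n≢0 _ _ {{c !≢0}} {{(n ∸ (a + c)) !≢0}}}}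
    a≤n : a ≤ n
    a≤n = m+n≤o⇒m≤o a a+c≤n
    c≤n∸a : c ≤ n ∸ a
    c≤n∸a = subst (_≤ n ∸ a) (m+n∸m≡n a c) (∸-monoˡ-≤ a a+c≤n)
    regroup : ∀ x y u v w → x * y * (u * (v * w)) ≡ x * (u * (y * (v * w)))
    regroup = solve-∀
    regroup′ : ∀ x y u v w → x * (y * (u * v) * w) ≡ x * y * (u * (v * w))
    regroup′ = solve-∀
  ... | no a+c≰n | yes a≤n = begin-equality
    (n C a) * ((n ∸ a) C c)        ≡⟨ cong ((n C a) *_) (k>n⇒nCk≡0 n∸a<c) ⟩
    (n C a) * 0                    ≡⟨ *-zeroʳ (n C a) ⟩
    0                              ≡⟨ cong (_* ((a + c) C a)) (k>n⇒nCk≡0 (≰⇒> a+c≰n)) ⟨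
    (n C (a + c)) * ((a + c) C a)  ∎
    where
    n∸a<c : n ∸ a < c
    n∸a<c = subst (n ∸ a <_) (m+n∸m≡n a c) (∸-monoˡ-< (≰⇒> a+c≰n) a≤n)
  ... | no a+c≰n | no a≰n = begin-equality
    (n C a) * ((n ∸ a) C c)        ≡⟨ cong (_* ((n ∸ a) C c)) (k>n⇒nCk≡0 (≰⇒> a≰n)) ⟩
    0                              ≡⟨ cong (_* ((a + c) C a)) (k>n⇒nCk≡0 (≰⇒> a+c≰n)) ⟨
    (n C (a + c)) * ((a + c) C a)  ∎

  [a+b]C[1+b]≤[1+a+b]Ca : ∀ a b → (a + b) C suc b ≤ suc (a + b) C a
  [a+b]C[1+b]≤[1+a+b]Ca zero    b = ≤-trans (≤-reflexive (k>n⇒nCk≡0 (n<1+n b))) z≤n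
  [a+b]C[1+b]≤[1+a+b]Ca (suc a) b = begin
    (suc a + b) C suc b                      ≡⟨ nCk≡nC[n∸k] (s≤s (m≤n+m b a)) ⟩
    (suc a + b) C (a + b ∸ b)                ≡⟨ cong ((suc a + b) C_) (m+n∸n≡m a b) ⟩
    (suc a + b) C a                          ≤⟨ m≤m+n _ _ ⟩
    (suc a + b) C a + (suc a + b) C suc a    ≡⟨ nCk+nC[k+1]≡[n+1]C[k+1] (suc a + b) a ⟩
    suc (suc a + b) C suc a                  ∎

  [a+b]C[1+a]+[a+b]C[1+b]≤[2+a+b]C[1+a] : ∀ a b →
    (a + b) C suc a + (a + b) C suc b ≤ (2 + (a + b)) C suc a
  [a+b]C[1+a]+[a+b]C[1+b]≤[2+a+b]C[1+a] a b = begin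
    (a + b) C suc a + (a + b) C suc b
      ≤⟨ +-mono-≤ (nCk≤[1+n]Ck (a + b) (suc a)) ([a+b]C[1+b]≤[1+a+b]Ca a b) ⟩
    suc (a + b) C suc a + suc (a + b) C a    ≡⟨ +-comm (suc (a + b) C suc a) _ ⟩
    suc (a + b) C a + suc (a + b) C suc a    ≡⟨ nCk+nC[k+1]≡[n+1]C[k+1] (suc (a + b)) a ⟩
    (2 + (a + b)) C suc a                    ∎

module FiniteDifferences where
  open import Data.Nat as ℕ using (ℕ; suc)
  import Data.Nat.Properties as ℕ
  open import Data.Integer hiding (suc)
  open import Data.Integer.Properties
  open import Data.Integer.Tactic.RingSolver using (solve-∀)
  open import Relation.Binary.PropositionalEquality

  Δ : (ℕ → ℤ) → ℕ → ℤ
  Δ f t = f (suc t) - f t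

  Δ² : (ℕ → ℤ) → ℕ → ℤ
  Δ² f = Δ (Δ f)

  Δ-cong : ∀ {f g : ℕ → ℤ} t → (∀ t → f t ≡ g t) → Δ f t ≡ Δ g t
  Δ-cong t f≗g = cong₂ _-_ (f≗g (suc t)) (f≗g t)

  Δ²-+ : ∀ (f g : ℕ → ℤ) t → Δ² (λ t → f t + g t) t ≡ Δ² f t + Δ² g t
  Δ²-+ f g t = identity (f t) (f (suc t)) (f (suc (suc t))) (g t) (g (suc t)) (g (suc (suc t)))
    where
    identity : ∀ f₀ f₁ f₂ g₀ g₁ g₂ →
      ((f₂ + g₂) - (f₁ + g₁)) - ((f₁ + g₁) - (f₀ + g₀)) ≡
      ((f₂ - f₁) - (f₁ - f₀)) + ((g₂ - g₁) - (g₁ - g₀))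
    identity = solve-∀

  Δ²-*ʳ : ∀ (f : ℕ → ℤ) c t → Δ² (λ t → f t * c) t ≡ Δ² f t * c
  Δ²-*ʳ f c t = identity (f t) (f (suc t)) (f (suc (suc t))) c
    where
    identity : ∀ f₀ f₁ f₂ c →
      ((f₂ * c) - (f₁ * c)) - ((f₁ * c) - (f₀ * c)) ≡ ((f₂ - f₁) - (f₁ - f₀)) * c
    identity = solve-∀

  Δ[c-f][t]≡f[t]-f[1+t] : ∀ c (f : ℕ → ℤ) t → Δ (λ t → c - f t) t ≡ f t - f (suc t)
  Δ[c-f][t]≡f[t]-f[1+t] c f t = identity c (f t) (f (suc t))
    where
    identity : ∀ c f₀ f₁ → (c - f₁) - (c - f₀) ≡ f₀ - f₁
    identity = solve-∀

  Δ²[c-f]≡-Δ²f : ∀ c (f : ℕ → ℤ) t → Δ² (λ t → c - f t) t ≡ - Δ² f t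
  Δ²[c-f]≡-Δ²f c f t = identity c (f t) (f (suc t)) (f (suc (suc t)))
    where
    identity : ∀ c f₀ f₁ f₂ →
      ((c - f₂) - (c - f₁)) - ((c - f₁) - (c - f₀)) ≡ - ((f₂ - f₁) - (f₁ - f₀))
    identity = solve-∀

  Δ²-* : ∀ (u v : ℕ → ℤ) t → Δ² (λ t → u t * v t) t ≡
    u (suc t) * Δ² v t + v (suc t) * Δ² u t + Δ u (suc t) * Δ v (suc t) + Δ u t * Δ v t
  Δ²-* u v t = identity (u t) (u (suc t)) (u (suc (suc t))) (v t) (v (suc t)) (v (suc (suc t)))
    where
    identity : ∀ u₀ u₁ u₂ v₀ v₁ v₂ →
      ((u₂ * v₂) - (u₁ * v₁)) - ((u₁ * v₁) - (u₀ * v₀)) ≡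
      u₁ * ((v₂ - v₁) - (v₁ - v₀)) + v₁ * ((u₂ - u₁) - (u₁ - u₀))
        + (u₂ - u₁) * (v₂ - v₁) + (u₁ - u₀) * (v₁ - v₀)
    identity = solve-∀

  Δ²-shift : ∀ (f g : ℕ → ℤ) X Y → (∀ i → f (i ℕ.+ X) ≡ g (i ℕ.+ Y)) → Δ² f X ≡ Δ² g Y
  Δ²-shift f g X Y f≗g = cong₂ _-_ (cong₂ _-_ (f≗g 2) (f≗g 1)) (cong₂ _-_ (f≗g 1) (f≗g 0))

  Δ²-reflect : ∀ (f g : ℕ → ℤ) {m} X T → X ℕ.+ (2 ℕ.+ T) ≡ m →
    (∀ x t → x ℕ.+ t ≡ m → f t ≡ g x) → Δ² f T ≡ Δ² g X
  Δ²-reflect f g X T X+2+T≡m f≗g = begin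
    (f (2 ℕ.+ T) - f (1 ℕ.+ T)) - (f (1 ℕ.+ T) - f T)
      ≡⟨ cong₂ _-_ (cong₂ _-_ g₀ g₁) (cong₂ _-_ g₁ g₂) ⟩
    (g X - g (1 ℕ.+ X)) - (g (1 ℕ.+ X) - g (2 ℕ.+ X))
      ≡⟨ reverse (g X) (g (1 ℕ.+ X)) (g (2 ℕ.+ X)) ⟩
    (g (2 ℕ.+ X) - g (1 ℕ.+ X)) - (g (1 ℕ.+ X) - g X)  ∎
    where
    open ≡-Reasoning
    g₀ = f≗g X (2 ℕ.+ T) X+2+T≡m
    g₁ = f≗g (1 ℕ.+ X) (1 ℕ.+ T) (trans (sym (ℕ.+-suc X (suc T))) X+2+T≡m)
    g₂ = f≗g (2 ℕ.+ X) T (trans (sym (trans (ℕ.+-suc X (suc T)) (cong suc (ℕ.+-suc X T)))) X+2+T≡m)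
    reverse : ∀ g₀ g₁ g₂ → (g₀ - g₁) - (g₁ - g₂) ≡ (g₂ - g₁) - (g₁ - g₀)
    reverse = solve-∀

  u[1+t]*Δ²v≤Δ²[u*v] : ∀ (u v : ℕ → ℤ) t → (∀ t → 0ℤ ≤ Δ u t) → (∀ t → 0ℤ ≤ Δ v t) →
    0ℤ ≤ Δ² u t → 0ℤ ≤ v (suc t) →
    u (suc t) * Δ² v t ≤ Δ² (λ t → u t * v t) t
  u[1+t]*Δ²v≤Δ²[u*v] u v t 0≤Δu 0≤Δv 0≤Δ²u 0≤v₁ = begin
    u (suc t) * Δ² v t
      ≤⟨ i≤i+j′ (0≤i*j 0≤v₁ 0≤Δ²u) ⟩
    u (suc t) * Δ² v t + v (suc t) * Δ² u t
      ≤⟨ i≤i+j′ (0≤i*j (0≤Δu (suc t)) (0≤Δv (suc t))) ⟩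
    u (suc t) * Δ² v t + v (suc t) * Δ² u t + Δ u (suc t) * Δ v (suc t)
      ≤⟨ i≤i+j′ (0≤i*j (0≤Δu t) (0≤Δv t)) ⟩
    u (suc t) * Δ² v t + v (suc t) * Δ² u t + Δ u (suc t) * Δ v (suc t) + Δ u t * Δ v t
      ≡⟨ Δ²-* u v t ⟨
    Δ² (λ t → u t * v t) t ∎
    where
    open ≤-Reasoning
    i≤i+j′ : ∀ {i j} → 0ℤ ≤ j → i ≤ i + j
    i≤i+j′ {i} {j} 0≤j = i≤i+j i j {{nonNegative 0≤j}}
    0≤i*j : ∀ {i j} → 0ℤ ≤ i → 0ℤ ≤ j → 0ℤ ≤ i * j
    0≤i*j {+ m} {+ n} _ _ = subst (0ℤ ≤_) (pos-* m n) (+≤+ ℕ.z≤n)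

  0≤Δ²⇒2*f[1+t]≤f[2+t]+f[t] : ∀ (f : ℕ → ℤ) t → 0ℤ ≤ Δ² f t →
    + 2 * f (suc t) ≤ f (suc (suc t)) + f t
  0≤Δ²⇒2*f[1+t]≤f[2+t]+f[t] f t 0≤Δ²f =
    0≤i-j⇒j≤i (subst (0ℤ ≤_) (identity (f t) (f (suc t)) (f (suc (suc t)))) 0≤Δ²f)
    where
    identity : ∀ f₀ f₁ f₂ → (f₂ - f₁) - (f₁ - f₀) ≡ (f₂ + f₀) - + 2 * f₁
    identity = solve-∀

module IntegerBinomials where
  open import Data.Nat as ℕ using (ℕ; suc)
  open import Data.Nat.Properties as ℕ using ()
  open import Data.Nat.Combinatorics using (_C_; nCk+nC[k+1]≡[n+1]C[k+1])
  open import Data.Integer hiding (suc)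
  open import Data.Integer.Properties
  open import Relation.Binary.PropositionalEquality
  open BinomialCoefficients
  open FiniteDifferences

  +m-+n≡+[m∸n] : ∀ {m n} → n ℕ.≤ m → + m - + n ≡ + (m ℕ.∸ n)
  +m-+n≡+[m∸n] {m} {n} n≤m = trans ([+m]-[+n]≡m⊖n m n) (⊖-≥ n≤m)

  +[o+n]-+n≡+o : ∀ o n {m} → o ℕ.+ n ≡ m → + m - + n ≡ + o
  +[o+n]-+n≡+o o n refl = trans (+m-+n≡+[m∸n] (ℕ.m≤n+m n o)) (cong +_ (ℕ.m+n∸n≡m o n))

  0≤binom : ∀ i k → 0ℤ ≤ binom i k
  0≤binom (+ _)      (+ _)      = +≤+ ℕ.z≤n
  0≤binom (+ _)      -[1+ _ ]   = +≤+ ℕ.z≤n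
  0≤binom -[1+ _ ]   _          = +≤+ ℕ.z≤n

  binom-monoˡ-≤ : ∀ k {i j} → i ≤ j → binom i k ≤ binom j k
  binom-monoˡ-≤ k        {j = j} -≤+       = 0≤binom j k
  binom-monoˡ-≤ k                (-≤- _)   = ≤-refl
  binom-monoˡ-≤ (+ k)            (+≤+ m≤n) = +≤+ (C-monoˡ-≤ k m≤n)
  binom-monoˡ-≤ -[1+ _ ]         (+≤+ _)   = ≤-refl

  0≤Δ-C : ∀ k z → 0ℤ ≤ Δ (λ y → + (y C k)) z
  0≤Δ-C k z = i≤j⇒0≤j-i (+≤+ (nCk≤[1+n]Ck z k))

  Δ-C : ∀ k z → Δ (λ y → + (y C suc k)) z ≡ + (z C k)
  Δ-C k z = +[o+n]-+n≡+o (z C k) (z C suc k) (nCk+nC[k+1]≡[n+1]C[k+1] z k)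

  Δ²-C : ∀ k z → Δ² (λ y → + (y C suc k)) z ≡ Δ (λ y → + (y C k)) z
  Δ²-C k z = Δ-cong z (Δ-C k)

module Convexity (n m : ℕ) where
  open import Data.Nat as ℕ using (ℕ; zero; suc; _∸_)
  open import Data.Nat.Properties as ℕ using ()
  open import Data.Nat.Combinatorics using (_C_; k>n⇒nCk≡0)
  open import Data.Integer hiding (suc)
  open import Data.Integer.Properties
  open import Data.Integer.Tactic.RingSolver using (solve-∀)
  open import Relation.Binary.PropositionalEquality
  open import Relation.Nullary using (yes; no)
  open BinomialCoefficients
  open FiniteDifferences
  open IntegerBinomials

  h-leading : ℕ → ℕ → ℕ → ℤ
  h-leading r p t = binom (+ m - + t) (+ r) * binom (+ r) (+ p)

  -- k stands for the integer r - p, left unevaluated so that h unfolds definitionally into these summands.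
  h-summand : ℕ → ℤ → ℕ → ℤ
  h-summand p k t = binom (+ t) (+ p) * (binom (+ n - + p - + 1) k - binom (+ m - + t - + p) k)

  module _ {X T : ℕ} (X+2+T≡m : X ℕ.+ (2 ℕ.+ T) ≡ m) (2+X≤n : 2 ℕ.+ X ℕ.≤ n) (1+T≤X : suc T ℕ.≤ X)
    where

    Δ²-h-leading : ∀ {r} k p → r ≡ 2 ℕ.+ k → Δ² (h-leading r p) T ≡ + (X C k) * + (r C p)
    Δ²-h-leading {r} k p refl = begin
      Δ² (h-leading r p) T                  ≡⟨ Δ²-*ʳ c K T ⟩
      Δ² c T * K
        ≡⟨ cong (_* K) (Δ²-reflect c (λ x → + (x C r)) X T X+2+T≡m c≡) ⟩
      Δ² (λ x → + (x C r)) X * K            ≡⟨ cong (_* K) (trans (Δ²-C (suc k) X) (Δ-C k X)) ⟩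
      + (X C k) * K                         ∎
      where
      open ≡-Reasoning
      K = + (r C p)
      c : ℕ → ℤ
      c t = binom (+ m - + t) (+ r)
      c≡ : ∀ x t → x ℕ.+ t ≡ m → c t ≡ + (x C r)
      c≡ x t x+t≡m = cong (λ i → binom i (+ r)) (+[o+n]-+n≡+o x t x+t≡m)

    [1+T]C[1+a]*ΔC≤XC[a+b]*[a+b]C[1+a] : ∀ a b →
      + (suc T C suc a) * Δ (λ y → + (y C b)) (X ∸ suc a) ≤ + ((X C (a ℕ.+ b)) ℕ.* ((a ℕ.+ b) C suc a))
    [1+T]C[1+a]*ΔC≤XC[a+b]*[a+b]C[1+a] a zero =
      ≤-trans (≤-reflexive (*-zeroʳ (+ (suc T C suc a)))) (+≤+ ℕ.z≤n)
    [1+T]C[1+a]*ΔC≤XC[a+b]*[a+b]C[1+a] a (suc b) = begin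
      + (suc T C suc a) * Δ (λ y → + (y C suc b)) (X ∸ suc a)
        ≡⟨ cong (+ (suc T C suc a) *_) (Δ-C b (X ∸ suc a)) ⟩
      + (suc T C suc a) * + ((X ∸ suc a) C b)
        ≡⟨ pos-* (suc T C suc a) ((X ∸ suc a) C b) ⟨
      + ((suc T C suc a) ℕ.* ((X ∸ suc a) C b))
        ≤⟨ +≤+ (ℕ.*-monoˡ-≤ ((X ∸ suc a) C b) (C-monoˡ-≤ (suc a) 1+T≤X)) ⟩
      + ((X C suc a) ℕ.* ((X ∸ suc a) C b))
        ≡⟨ cong +_ (nCa*[n∸a]Cc≡nC[a+c]*[a+c]Ca X (suc a) b) ⟩
      + ((X C (suc a ℕ.+ b)) ℕ.* ((suc a ℕ.+ b) C suc a))
        ≡⟨ cong (λ c → + ((X C c) ℕ.* (c C suc a))) (ℕ.+-suc a b) ⟨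
      + ((X C (a ℕ.+ suc b)) ℕ.* ((a ℕ.+ suc b) C suc a)) ∎
      where open ≤-Reasoning

    Δ²-binom-reflect : ∀ p b → p ℕ.≤ X →
      Δ² (λ t → binom (+ m - + t - + p) (+ suc b)) T ≡ Δ (λ y → + (y C b)) (X ∸ p)
    Δ²-binom-reflect p b p≤X = begin
      Δ² w T                            ≡⟨ Δ²-reflect w g X T X+2+T≡m w≡ ⟩
      Δ² g X                            ≡⟨ Δ²-shift g (λ y → + (y C suc b)) X (X ∸ p) g≡ ⟩
      Δ² (λ y → + (y C suc b)) (X ∸ p)  ≡⟨ Δ²-C b (X ∸ p) ⟩
      Δ (λ y → + (y C b)) (X ∸ p)       ∎
      where
      open ≡-Reasoning
      w g : ℕ → ℤ
      w t = binom (+ m - + t - + p) (+ suc b)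
      g x = binom (+ x - + p) (+ suc b)
      w≡ : ∀ x t → x ℕ.+ t ≡ m → w t ≡ g x
      w≡ x t x+t≡m = cong (λ i → binom (i - + p) (+ suc b)) (+[o+n]-+n≡+o x t x+t≡m)
      g≡ : ∀ i → g (i ℕ.+ X) ≡ + ((i ℕ.+ (X ∸ p)) C suc b)
      g≡ i = cong (λ j → binom j (+ suc b))
        (trans (+m-+n≡+[m∸n] (ℕ.≤-trans p≤X (ℕ.m≤n+m X i))) (cong +_ (ℕ.+-∸-assoc i p≤X)))

    -[XCc*cC[1+a]]≤Δ²-h-summand : ∀ {a b c k} → k ≡ + suc b → a ℕ.+ b ≡ c →
      - + ((X C c) ℕ.* (c C suc a)) ≤ Δ² (h-summand (suc a) k) T
    -[XCc*cC[1+a]]≤Δ²-h-summand {a} {b} refl refl = begin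
      - + ((X C (a ℕ.+ b)) ℕ.* ((a ℕ.+ b) C suc a))  ≤⟨ neg-mono-≤ u[1+T]*Δ²w≤ ⟩
      - (u (suc T) * Δ² w T)                        ≡⟨ neg-distribʳ-* (u (suc T)) (Δ² w T) ⟩
      u (suc T) * - Δ² w T                          ≡⟨ cong (u (suc T) *_) (Δ²[c-f]≡-Δ²f N w T) ⟨
      u (suc T) * Δ² v T
        ≤⟨ u[1+t]*Δ²v≤Δ²[u*v] u v T (0≤Δ-C (suc a)) 0≤Δv 0≤Δ²u 0≤v[1+T] ⟩
      Δ² (h-summand (suc a) (+ suc b)) T            ∎
      where
      open ≤-Reasoning
      p = suc a
      u w v : ℕ → ℤ
      u t = + (t C p)
      w t = binom (+ m - + t - + p) (+ suc b)
      N = binom (+ n - + p - + 1) (+ suc b)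
      v t = N - w t

      0≤Δ²u : 0ℤ ≤ Δ² u T
      0≤Δ²u = subst (0ℤ ≤_) (sym (Δ²-C a T)) (0≤Δ-C a T)

      0≤Δv : ∀ t → 0ℤ ≤ Δ v t
      0≤Δv t = subst (0ℤ ≤_) (sym (Δ[c-f][t]≡f[t]-f[1+t] N w t)) (i≤j⇒0≤j-i (binom-monoˡ-≤ (+ suc b)
        (+-monoˡ-≤ (- + p) (+-monoʳ-≤ (+ m) (neg-mono-≤ (+≤+ (ℕ.n≤1+n t)))))))

      0≤v[1+T] : 0ℤ ≤ v (suc T)
      0≤v[1+T] = i≤j⇒0≤j-i (binom-monoˡ-≤ (+ suc b) (begin
        + m - + suc T - + p
          ≡⟨ cong (_- + p) (+[o+n]-+n≡+o (suc X) (suc T) (trans (sym (ℕ.+-suc X (suc T))) X+2+T≡m)) ⟩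
        + suc X - + p        ≤⟨ +-monoˡ-≤ (- + p) 1+X≤n-1 ⟩
        + n - + 1 - + p      ≡⟨ swap (+ n) (+ 1) (+ p) ⟩
        + n - + p - + 1      ∎))
        where
        swap : ∀ i j k → i - j - k ≡ i - k - j
        swap = solve-∀
        1+X≤n-1 : + suc X ≤ + n - + 1
        1+X≤n-1 = subst (+ suc X ≤_) (sym (+m-+n≡+[m∸n] (ℕ.≤-trans (ℕ.s≤s ℕ.z≤n) 2+X≤n)))
          (+≤+ (ℕ.m+n≤o⇒m≤o∸n (suc X) (subst (ℕ._≤ n) (ℕ.+-comm 1 (suc X)) 2+X≤n)))

      u[1+T]*Δ²w≤ : u (suc T) * Δ² w T ≤ + ((X C (a ℕ.+ b)) ℕ.* ((a ℕ.+ b) C suc a))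
      u[1+T]*Δ²w≤ with p ℕ.≤? X
      ... | yes p≤X = subst (λ d → u (suc T) * d ≤ _) (sym (Δ²-binom-reflect p b p≤X))
                            ([1+T]C[1+a]*ΔC≤XC[a+b]*[a+b]C[1+a] a b)
      -- For X < p the argument of w turns negative near t = T, so Δ² w is no binomial; but u (1 + T) = 0.
      ... | no p≰X = subst (λ c → + c * Δ² w T ≤ _) (sym (k>n⇒nCk≡0 (ℕ.≤-<-trans 1+T≤X (ℕ.≰⇒> p≰X))))
                           (+≤+ ℕ.z≤n)

    0≤Δ²h : ∀ a b → 0ℤ ≤ Δ² (h n m (suc a) (suc b)) T
    0≤Δ²h a b = begin
      0ℤ                                  ≤⟨ i≤j⇒0≤j-i weights ⟩
      + (X C k) * K - (+ B₁ + + B₂)       ≡⟨ regroup (+ (X C k) * K) (+ B₁) (+ B₂) ⟩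
      + (X C k) * K + - + B₁ + - + B₂
        ≤⟨ +-mono-≤ (+-mono-≤ (≤-reflexive (sym Δ²L)) -B₁≤Δ²H₁) -B₂≤Δ²H₂ ⟩
      Δ² L T + Δ² H₁ T + Δ² H₂ T          ≡⟨ cong (_+ Δ² H₂ T) (Δ²-+ L H₁ T) ⟨
      Δ² (λ t → L t + H₁ t) T + Δ² H₂ T   ≡⟨ Δ²-+ (λ t → L t + H₁ t) H₂ T ⟨
      Δ² (h n m (suc a) (suc b)) T        ∎
      where
      open ≤-Reasoning
      r = suc a ℕ.+ suc b
      k = a ℕ.+ b
      K = + (r C suc a)
      L = h-leading r (suc a)
      H₁ = h-summand (suc a) (+ r - + suc a)
      H₂ = h-summand (suc b) (+ r - + suc b)
      B₁ = (X C k) ℕ.* (k C suc a)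
      B₂ = (X C k) ℕ.* (k C suc b)

      Δ²L : Δ² L T ≡ + (X C k) * K
      Δ²L = Δ²-h-leading k (suc a) (cong suc (ℕ.+-suc a b))
      -B₁≤Δ²H₁ : - + B₁ ≤ Δ² H₁ T
      -B₁≤Δ²H₁ = -[XCc*cC[1+a]]≤Δ²-h-summand {a} {b}
        (+[o+n]-+n≡+o (suc b) (suc a) (ℕ.+-comm (suc b) (suc a))) refl
      -B₂≤Δ²H₂ : - + B₂ ≤ Δ² H₂ T
      -B₂≤Δ²H₂ = -[XCc*cC[1+a]]≤Δ²-h-summand {b} {a}
        (+[o+n]-+n≡+o (suc a) (suc b) refl) (ℕ.+-comm b a)

      regroup : ∀ l i j → l - (i + j) ≡ l + - i + - j
      regroup = solve-∀
      weights : + B₁ + + B₂ ≤ + (X C k) * K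
      weights = subst₂ _≤_ (pos-+ B₁ B₂) (pos-* (X C k) (r C suc a)) (+≤+ (ℕ.≤-trans
        (ℕ.≤-reflexive (sym (ℕ.*-distribˡ-+ (X C k) (k C suc a) (k C suc b))))
        (ℕ.*-monoʳ-≤ (X C k) (subst (λ c → k C suc a ℕ.+ k C suc b ℕ.≤ c C suc a) (cong suc (sym (ℕ.+-suc a b)))
                                    ([a+b]C[1+a]+[a+b]C[1+b]≤[2+a+b]C[1+a] a b)))))

  h-convex : ∀ a b T → m ℕ.≤ n → 2 ℕ.* suc T ℕ.< m → 0ℤ ≤ Δ² (h n m (suc a) (suc b)) T
  h-convex a b T m≤n 2[1+T]<m = 0≤Δ²h X+2+T≡m 2+X≤n 1+T≤X a b
    where
    X = m ∸ (2 ℕ.+ T)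
    [1+T]+[2+T]≤m : suc T ℕ.+ (2 ℕ.+ T) ℕ.≤ m
    [1+T]+[2+T]≤m = subst (ℕ._≤ m) 1+2[1+T]≡[1+T]+[2+T] 2[1+T]<m
      where
      1+2[1+T]≡[1+T]+[2+T] : suc (2 ℕ.* suc T) ≡ suc T ℕ.+ (2 ℕ.+ T)
      1+2[1+T]≡[1+T]+[2+T] = trans (cong (λ i → suc (suc T ℕ.+ i)) (ℕ.+-identityʳ (suc T)))
                                   (sym (ℕ.+-suc (suc T) (suc T)))
    X+2+T≡m : X ℕ.+ (2 ℕ.+ T) ≡ m
    X+2+T≡m = ℕ.m∸n+n≡m (ℕ.≤-trans (ℕ.m≤n+m (2 ℕ.+ T) (suc T)) [1+T]+[2+T]≤m)
    1+T≤X : suc T ℕ.≤ X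
    1+T≤X = ℕ.m+n≤o⇒m≤o∸n (suc T) [1+T]+[2+T]≤m
    2+X≤n : 2 ℕ.+ X ℕ.≤ n
    2+X≤n = ℕ.≤-trans (subst (2 ℕ.+ X ℕ.≤_) X+2+T≡m 2+X≤X+2+T) m≤n
      where
      2+X≤X+2+T : 2 ℕ.+ X ℕ.≤ X ℕ.+ (2 ℕ.+ T)
      2+X≤X+2+T = subst (ℕ._≤ X ℕ.+ (2 ℕ.+ T)) (ℕ.+-comm X 2) (ℕ.+-monoʳ-≤ X (ℕ.m≤m+n 2 T))

open import Data.Nat using (ℕ; _≤_; _<_; _+_; _*_; _∸_; suc; s≤s; z≤n)
open import Data.Integer using () renaming (_+_ to _+ᶻ_; _*_ to _*ᶻ_; _≤_ to _≤ᶻ_; +_ to ℤ+_)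
open import Data.Nat.Properties using (+-comm; ≤-trans; m≤m+n; m<m+n; *-monoʳ-<)
open import Relation.Binary.PropositionalEquality using (subst)
open FiniteDifferences using (0≤Δ²⇒2*f[1+t]≤f[2+t]+f[t])
open Convexity using (h-convex)

lemma2p7 : (n m r₁ r₂ : ℕ) → 1 ≤ n → 1 ≤ m → 1 ≤ r₁ → 1 ≤ r₂ →
    m + 1 ≤ n → 5 ≤ m + 1 →
    (t : ℕ) → 1 ≤ t → 2 ≤ t → 2 * (t + 1) ≤ m →
    (ℤ+ 2) *ᶻ h n m r₁ r₂ t ≤ᶻ h n m r₁ r₂ (t + 1) +ᶻ h n m r₁ r₂ (t ∸ 1)
lemma2p7 n m (suc a) (suc b) _ _ _ _ m+1≤n _ (suc T) _ _ 2[t+1]≤m =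
  subst (λ t+1 → ℤ+ 2 *ᶻ f (suc T) ≤ᶻ f t+1 +ᶻ f T) (+-comm 1 (suc T))
    (0≤Δ²⇒2*f[1+t]≤f[2+t]+f[t] f T (h-convex n m a b T m≤n 2[1+T]<m))
  where
  f = h n m (suc a) (suc b)
  m≤n : m ≤ n
  m≤n = ≤-trans (m≤m+n m 1) m+1≤n
  2[1+T]<m : 2 * suc T < m
  2[1+T]<m = ≤-trans (*-monoʳ-< 2 (m<m+n (suc T) (s≤s z≤n))) 2[t+1]≤m
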